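{- Let $\mathcal P$ be a $d$-floorplan, $B$ a block of $\mathcal P$ and $q$ a corner of $B$ that is not on the boundary of the bounding box of $\mathcal P$. Let $\mathcal F_{B,q}$ be the set of facets of $B$ containing $q$ and $b(\mathcal F_{B,q})=\{b(f): f\in\mathcal F_{B,q}\}$. Then the relation "touches" is a total order on $b(\mathcal F_{B,q})$.
   Context: A $d$-dimensional floorplan is a box (bounding box) partitioned into finitely many boxes (blocks) with pairwise disjoint interiors. A facet of axis $j$ is an axis-parallel hyperrectangle whose $j$-th interval is a point and the others nondegenerate; its interior replaces each nondegenerate $[a,b]$ by $(a,b)$. The border of axis $j$ at position $t$ (interior to the bounding box range) is the union of all block facets of axis $j$ in the hyperplane $x_j=t$; $b(f)$ is the border containing the facet $f$. A $d$-floorplan is a floorplan in which every border is a single facet (generic) and no two borders cross (tatami). Facets $f,f'$ cross if their interiors intersect; $f$ properly touches $f'$ if the interior of $f$ intersects $f'$ and they do not cross; $f$ touches $f'$ if $f=f'$ or $f$ properly touches $f'$.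
   Formalization: All points, and the bounding box, blocks, facets and borders of the $d$-floorplan, have rational coordinates. -}

module Defs where

open import Data.Nat using (ℕ)
open import Data.Fin using (Fin; _≟_)
open import Data.Rational using (ℚ; _<_; _≤_)
open import Data.Product using (Σ; ∃; ∃-syntax; _×_; _,_; proj₁; proj₂)
open import Data.Sum using (_⊎_)
open import Relation.Binary.PropositionalEquality using (_≡_; _≢_)
open import Relation.Nullary using (¬_; yes; no)

Point : ℕ → Set
Point d = Fin d → ℚ

-- An axis-parallel (possibly degenerate) hyperrectangle, given by its
-- d coordinate intervals [lo i , hi i].
Rect : ℕ → Set
Rect d = Fin d → ℚ × ℚ

lo : ∀ {d} → Rect d → Fin d → ℚ
lo r i = proj₁ (r i)

hi : ∀ {d} → Rect d → Fin d → ℚ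
hi r i = proj₂ (r i)

_∈R_ : ∀ {d} → Point d → Rect d → Set
x ∈R r = ∀ i → lo r i ≤ x i × x i ≤ hi r i

-- interior: every nondegenerate [a,b] replaced by (a,b); a point interval stays
InInt : ∀ {d} → Point d → Rect d → Set
InInt x r = ∀ i → (lo r i < hi r i × lo r i < x i × x i < hi r i)
                  ⊎ (lo r i ≡ hi r i × x i ≡ lo r i)

IsBox : ∀ {d} → Rect d → Set
IsBox r = ∀ i → lo r i < hi r i

-- a facet: an axis j together with a hyperrectangle whose j-th interval is a
-- point and whose other intervals are nondegenerate
Facet : ℕ → Set
Facet d = Fin d × Rect d

axis : ∀ {d} → Facet d → Fin d
axis = proj₁

rect : ∀ {d} → Facet d → Rect d
rect = proj₂

pos : ∀ {d} → Facet d → ℚ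
pos f = lo (rect f) (axis f)

IsFacet : ∀ {d} → Facet d → Set
IsFacet (j , r) = ∀ i → (i ≡ j → lo r i ≡ hi r i) × (i ≢ j → lo r i < hi r i)

_≐_ : ∀ {d} → Facet d → Facet d → Set
f ≐ g = axis f ≡ axis g × (∀ i → rect f i ≡ rect g i)

faceAt : ∀ {d} → Rect d → Fin d → ℚ → Rect d
faceAt r j t i with i ≟ j
... | yes _ = (t , t)
... | no _ = r i

IsFacetOf : ∀ {d} → Rect d → Facet d → Set
IsFacetOf B f =
  (∀ i → rect f i ≡ faceAt B (axis f) (lo B (axis f)) i)
  ⊎ (∀ i → rect f i ≡ faceAt B (axis f) (hi B (axis f)) i)

record Floorplan (d : ℕ) : Set where
  field
    bbox   : Rect d
    nblk   : ℕ
    block  : Fin nblk → Rect d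
open Floorplan public

IsFloorplan : ∀ {d} → Floorplan d → Set
IsFloorplan {d} P =
  IsBox (bbox P)
  × (∀ a → IsBox (block P a))
  × (∀ a (x : Point d) → x ∈R block P a → x ∈R bbox P)
  × (∀ (x : Point d) → x ∈R bbox P → ∃[ a ] (x ∈R block P a))
  × (∀ a b → a ≢ b → ¬ (∃[ x ] (InInt x (block P a) × InInt x (block P b))))

InteriorPos : ∀ {d} → Floorplan d → Fin d → ℚ → Set
InteriorPos P j t = lo (bbox P) j < t × t < hi (bbox P) j

InBorder : ∀ {d} → Floorplan d → Fin d → ℚ → Point d → Set
InBorder P j t x =
  ∃[ a ] ∃[ f ] (IsFacetOf (block P a) f × axis f ≡ j × pos f ≡ t × x ∈R rect f)

BorderExists : ∀ {d} → Floorplan d → Fin d → ℚ → Set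
BorderExists P j t =
  ∃[ a ] ∃[ f ] (IsFacetOf (block P a) f × axis f ≡ j × pos f ≡ t)

BorderAt : ∀ {d} → Floorplan d → Fin d → ℚ → Facet d → Set
BorderAt {d} P j t G =
  IsFacet G × axis G ≡ j
  × (∀ (x : Point d) → (x ∈R rect G → InBorder P j t x) × (InBorder P j t x → x ∈R rect G))

IsBorder : ∀ {d} → Floorplan d → Facet d → Set
IsBorder P G = ∃[ j ] ∃[ t ] (InteriorPos P j t × BorderExists P j t × BorderAt P j t G)

IsBorderOf : ∀ {d} → Floorplan d → Facet d → Facet d → Set
IsBorderOf P f G = InteriorPos P (axis f) (pos f) × BorderAt P (axis f) (pos f) G

Cross : ∀ {d} → Facet d → Facet d → Set
Cross f g = ∃[ x ] (InInt x (rect f) × InInt x (rect g))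

ProperlyTouches : ∀ {d} → Facet d → Facet d → Set
ProperlyTouches f g = (∃[ x ] (InInt x (rect f) × x ∈R rect g)) × ¬ Cross f g

Touches : ∀ {d} → Facet d → Facet d → Set
Touches f g = f ≐ g ⊎ ProperlyTouches f g

IsGeneric : ∀ {d} → Floorplan d → Set
IsGeneric P = ∀ j t → InteriorPos P j t → BorderExists P j t
  → ∃[ G ] BorderAt P j t G

IsTatami : ∀ {d} → Floorplan d → Set
IsTatami P = ∀ G H → IsBorder P G → IsBorder P H → ¬ (G ≐ H) → ¬ Cross G H

IsDFloorplan : ∀ {d} → Floorplan d → Set
IsDFloorplan P = IsFloorplan P × IsGeneric P × IsTatami P

IsCorner : ∀ {d} → Point d → Rect d → Set
IsCorner q B = ∀ i → q i ≡ lo B i ⊎ q i ≡ hi B i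

OnBoundary : ∀ {d} → Point d → Rect d → Set
OnBoundary q R = q ∈R R × ∃[ i ] (q i ≡ lo R i ⊎ q i ≡ hi R i)

InFBq : ∀ {d} (P : Floorplan d) → Fin (nblk P) → Point d → Facet d → Set
InFBq P a q f = IsFacetOf (block P a) f × q ∈R rect f

InBFBq : ∀ {d} (P : Floorplan d) → Fin (nblk P) → Point d → Facet d → Set
InBFBq P a q G = ∃[ f ] (InFBq P a q f × IsBorderOf P f G)

-- R is a total order on the set S (elements of S identified up to ≐)
record TotalOrderOn {d} (S : Facet d → Set) (R : Facet d → Facet d → Set) : Set where
  field
    refl′   : ∀ G → S G → R G G
    antisym : ∀ G H → S G → S H → R G H → R H G → G ≐ H
    trans′  : ∀ G H K → S G → S H → S K → R G H → R H K → R G K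
    total   : ∀ G H → S G → S H → R G H ⊎ R H G

{-# OPTIONS --safe #-}
module Submission where

-- Every border G in b(F_{B,q}) is the border of some axis j through q: it is
-- flat at q_j in axis j and spans B in every other axis. Two of them with the
-- same axis coincide. For axes j ≢ k, G touches H exactly when q_k lies strictly
-- inside the k-interval of G ("G straddles k"), and the tatami condition forbids
-- two borders that straddle each other's axes. Totality and transitivity then
-- follow from one fact: for every nonempty set S of axes, the border through q
-- of some m ∈ S straddles all other axes of S. To find m, take a point p next to
-- q that lies outside B in the axes of S and inside B in the others, so close to
-- q that no block face lies strictly between them. The block C containing p is
-- not B, so C cannot overlap B in every axis; this forces C to have a face at q_m
-- for some m ∈ S, and that face, which lies in the border of axis m, reaches
-- past q in every other axis of S.

open import Defs
open import Data.Nat using (ℕ; zero; suc)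
open import Data.Fin using (Fin; zero; suc) renaming (_≟_ to _≟ᶠ_)
open import Data.Fin.Properties using () renaming (any? to anyFin?)
open import Data.List using (List; []; _∷_)
open import Data.List.Membership.Propositional using (_∈_)
open import Data.List.Relation.Unary.Any using (here; there) renaming (any? to anyList?)
open import Data.Rational using (ℚ; _<_; _≤_; _⊓_; _⊔_)
open import Data.Rational.Properties
  using ( ≤-refl; ≤-reflexive; ≤-trans; ≤-antisym; <⇒≤; <-irrefl; <-trans
        ; <-≤-trans; ≤-<-trans; <-dense; <-cmp; ≮⇒≥; _<?_
        ; ⊓-sel; ⊔-sel; p⊓q≤p; p⊓q≤q; p≤p⊔q; p≤q⊔p )
  renaming (_≟_ to _≟ℚ_)
open import Data.Product using (∃; ∃-syntax; _×_; _,_; proj₁; proj₂)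
open import Data.Sum as Sum using (_⊎_; inj₁; inj₂)
open import Data.Empty using (⊥; ⊥-elim)
open import Data.Vec.Functional using (updateAt)
open import Data.Vec.Functional.Properties using (updateAt-updates; updateAt-minimal)
open import Function using (_∘_; id; const)
open import Relation.Binary.Definitions using (tri<; tri≈; tri>)
open import Relation.Binary.PropositionalEquality
  using (_≡_; _≢_; refl; sym; trans; cong; cong₂; subst; ≢-sym)
open import Relation.Nullary using (¬_; Dec; yes; no; contradiction)
open import Relation.Nullary.Decidable using (_×-dec_; _⊎-dec_)

≤∧≢⇒< : ∀ {x y : ℚ} → x ≤ y → x ≢ y → x < y
≤∧≢⇒< {x} {y} x≤y x≢y with <-cmp x y
... | tri< x<y _ _ = x<y
... | tri≈ _ x≡y _ = contradiction x≡y x≢y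
... | tri> _ _ y<x = contradiction (<-≤-trans y<x x≤y) (<-irrefl refl)

<-⊓ : ∀ {x y z : ℚ} → x < y → x < z → x < y ⊓ z
<-⊓ {x} {y} {z} x<y x<z with ⊓-sel y z
... | inj₁ y⊓z≡y = subst (x <_) (sym y⊓z≡y) x<y
... | inj₂ y⊓z≡z = subst (x <_) (sym y⊓z≡z) x<z

⊔-< : ∀ {x y z : ℚ} → x < z → y < z → x ⊔ y < z
⊔-< {x} {y} {z} x<z y<z with ⊔-sel x y
... | inj₁ x⊔y≡x = subst (_< z) (sym x⊔y≡x) x<z
... | inj₂ x⊔y≡y = subst (_< z) (sym x⊔y≡y) y<z

<-intervals-meet : ∀ {a b a′ b′ : ℚ} → a < b → a′ < b′ → a < b′ → a′ < b
  → ∃[ z ] ((a < z × z < b) × (a′ < z × z < b′))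
<-intervals-meet {a} {b} {a′} {b′} a<b a′<b′ a<b′ a′<b =
  let z , a⊔a′<z , z<b⊓b′ = <-dense (⊔-< (<-⊓ a<b a<b′) (<-⊓ a′<b a′<b′))
  in z , (≤-<-trans (p≤p⊔q a a′) a⊔a′<z , <-≤-trans z<b⊓b′ (p⊓q≤p b b′))
       , (≤-<-trans (p≤q⊔p a a′) a⊔a′<z , <-≤-trans z<b⊓b′ (p⊓q≤q b b′))

∃-gap-above : ∀ {n} (v : Fin n → ℚ) {x h : ℚ} → x < h
  → ∃[ y ] (x < y × y < h × ∀ c → v c ≤ y → v c ≤ x)
∃-gap-above {zero} v x<h =
  let y , x<y , y<h = <-dense x<h in y , x<y , y<h , λ ()
∃-gap-above {suc n} v {x} {h} x<h with x <? v zero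
... | yes x<v₀ =
  let y , x<y , y<v₀⊓h , gap = ∃-gap-above (v ∘ suc) (<-⊓ x<v₀ x<h)
  in y , x<y , <-≤-trans y<v₀⊓h (p⊓q≤q (v zero) h) , λ where
       zero v₀≤y → contradiction (≤-<-trans v₀≤y (<-≤-trans y<v₀⊓h (p⊓q≤p (v zero) h))) (<-irrefl refl)
       (suc c) → gap c
... | no x≮v₀ =
  let y , x<y , y<h , gap = ∃-gap-above (v ∘ suc) x<h
  in y , x<y , y<h , λ where
       zero _ → ≮⇒≥ x≮v₀
       (suc c) → gap c

∃-gap-below : ∀ {n} (v : Fin n → ℚ) {l x : ℚ} → l < x
  → ∃[ y ] (l < y × y < x × ∀ c → y ≤ v c → x ≤ v c)
∃-gap-below {zero} v l<x =
  let y , l<y , y<x = <-dense l<x in y , l<y , y<x , λ ()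
∃-gap-below {suc n} v {l} {x} l<x with v zero <? x
... | yes v₀<x =
  let y , v₀⊔l<y , y<x , gap = ∃-gap-below (v ∘ suc) (⊔-< v₀<x l<x)
  in y , ≤-<-trans (p≤q⊔p (v zero) l) v₀⊔l<y , y<x , λ where
       zero y≤v₀ → contradiction (<-≤-trans (≤-<-trans (p≤p⊔q (v zero) l) v₀⊔l<y) y≤v₀) (<-irrefl refl)
       (suc c) → gap c
... | no v₀≮x =
  let y , l<y , y<x , gap = ∃-gap-below (v ∘ suc) l<x
  in y , l<y , y<x , λ where
       zero _ → ≮⇒≥ v₀≮x
       (suc c) → gap c

updateAt-updates-earlier : ∀ {n} {A : Set} (x y : Fin n → A) (j k : Fin n)
  → updateAt (updateAt x j (const (y j))) k (const (y k)) j ≡ y j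
updateAt-updates-earlier x y j k with j ≟ᶠ k
... | yes refl = updateAt-updates j _
... | no j≢k = trans (updateAt-minimal j k _ j≢k) (updateAt-updates j x)

faceAt-axis : ∀ {d} (r : Rect d) j t → faceAt r j t j ≡ (t , t)
faceAt-axis r j t with j ≟ᶠ j
... | yes _ = refl
... | no j≢j = contradiction refl j≢j

faceAt-other : ∀ {d} (r : Rect d) j t {i} → i ≢ j → faceAt r j t i ≡ r i
faceAt-other r j t {i} i≢j with i ≟ᶠ j
... | yes i≡j = contradiction i≡j i≢j
... | no _ = refl

faceAt-isFacetOf : ∀ {d} (r : Rect d) j {t} → t ≡ lo r j ⊎ t ≡ hi r j
  → IsFacetOf r (j , faceAt r j t)
faceAt-isFacetOf r j = Sum.map (λ t≡lo i → cong (λ s → faceAt r j s i) t≡lo)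
                               (λ t≡hi i → cong (λ s → faceAt r j s i) t≡hi)

faceAt-lo≤hi : ∀ {d} (r : Rect d) j t → (∀ i → lo r i ≤ hi r i)
  → ∀ i → lo (faceAt r j t) i ≤ hi (faceAt r j t) i
faceAt-lo≤hi r j t lo≤hi i with i ≟ᶠ j
... | yes _ = ≤-refl
... | no _ = lo≤hi i

∈-faceAt : ∀ {d} (r : Rect d) j {t} {x : Point d} → x j ≡ t
  → (∀ i → i ≢ j → lo r i ≤ x i × x i ≤ hi r i) → x ∈R faceAt r j t
∈-faceAt r j x≡t x∈ i with i ≟ᶠ j
... | yes refl rewrite x≡t = ≤-refl , ≤-refl
... | no i≢j = x∈ i i≢j

IsFacetOf⇒pos≡ : ∀ {d} {r : Rect d} {f : Facet d} {x : Point d}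
  → IsFacetOf r f → x ∈R rect f → pos f ≡ x (axis f)
IsFacetOf⇒pos≡ {r = r} {f = j , s} {x} f∈r x∈f =
  ≤-antisym (proj₁ (x∈f j)) (subst (x j ≤_) (sym (Sum.[ flat , flat ]′ f∈r)) (proj₂ (x∈f j)))
  where
  flat : ∀ {t} → (∀ i → s i ≡ faceAt r j t i) → proj₁ (s j) ≡ proj₂ (s j)
  flat {t} s≡ = let sj≡ = trans (s≡ j) (faceAt-axis r j t)
                in trans (cong proj₁ sj≡) (sym (cong proj₂ sj≡))

IsFacet⇒lo≤hi : ∀ {d} {f : Facet d} → IsFacet f → ∀ i → lo (rect f) i ≤ hi (rect f) i
IsFacet⇒lo≤hi {f = f} facet i with i ≟ᶠ axis f
... | yes i≡j = ≤-reflexive (proj₁ (facet i) i≡j)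
... | no i≢j = <⇒≤ (proj₂ (facet i) i≢j)

⊆⇒bounds : ∀ {d} {r r′ : Rect d} → (∀ i → lo r i ≤ hi r i)
  → (∀ x → x ∈R r → x ∈R r′) → ∀ i → lo r′ i ≤ lo r i × hi r i ≤ hi r′ i
⊆⇒bounds {r = r} lo≤hi r⊆r′ i =
  proj₁ (r⊆r′ (lo r) (λ k → ≤-refl , lo≤hi k) i) , proj₂ (r⊆r′ (hi r) (λ k → lo≤hi k , ≤-refl) i)

IsCorner⇒∈R : ∀ {d} {x : Point d} {r : Rect d} → IsBox r → IsCorner x r → x ∈R r
IsCorner⇒∈R box corner i with corner i
... | inj₁ x≡lo rewrite x≡lo = ≤-refl , <⇒≤ (box i)
... | inj₂ x≡hi rewrite x≡hi = <⇒≤ (box i) , ≤-refl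

∈R∧¬OnBoundary⇒strict : ∀ {d} {x : Point d} {r : Rect d} → x ∈R r → ¬ OnBoundary x r
  → ∀ i → lo r i < x i × x i < hi r i
∈R∧¬OnBoundary⇒strict x∈ ¬∂ i =
  ≤∧≢⇒< (proj₁ (x∈ i)) (λ lo≡x → ¬∂ (x∈ , i , inj₁ (sym lo≡x)))
  , ≤∧≢⇒< (proj₂ (x∈ i)) (λ x≡hi → ¬∂ (x∈ , i , inj₂ x≡hi))

OpenOverlap : ∀ {d} → Rect d → Rect d → Fin d → Set
OpenOverlap r r′ i = ∃[ z ] ((lo r i < z × z < hi r i) × (lo r′ i < z × z < hi r′ i))

interiors-meet : ∀ {d} {r r′ : Rect d} → IsBox r → IsBox r′ → (∀ i → OpenOverlap r r′ i)
  → ∃[ x ] (InInt x r × InInt x r′)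
interiors-meet box box′ meet =
  (λ i → proj₁ (meet i))
  , (λ i → inj₁ (box i , proj₁ (proj₂ (meet i))))
  , (λ i → inj₁ (box′ i , proj₂ (proj₂ (meet i))))

module CornerBorders {d} (P : Floorplan d)
  (isBox    : ∀ c → IsBox (block P c))
  (⊆bbox    : ∀ c x → x ∈R block P c → x ∈R bbox P)
  (covers   : ∀ x → x ∈R bbox P → ∃[ c ] (x ∈R block P c))
  (disjoint : ∀ c c′ → c ≢ c′ → ¬ (∃[ x ] (InInt x (block P c) × InInt x (block P c′))))
  (tatami   : IsTatami P)
  (a : Fin (nblk P)) (q : Point d)
  (corner   : IsCorner q (block P a))
  (¬∂       : ¬ OnBoundary q (bbox P))
  where

  B : Rect d
  B = block P a

  q∈B : q ∈R B
  q∈B = IsCorner⇒∈R (isBox a) corner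

  q∈bbox-strict : ∀ i → lo (bbox P) i < q i × q i < hi (bbox P) i
  q∈bbox-strict = ∈R∧¬OnBoundary⇒strict (⊆bbox a q q∈B) ¬∂

  q<hi-B : ∀ {i} → q i ≡ lo B i → q i < hi B i
  q<hi-B {i} q≡lo = subst (_< hi B i) (sym q≡lo) (isBox a i)

  lo-B<q : ∀ {i} → q i ≡ hi B i → lo B i < q i
  lo-B<q {i} q≡hi = subst (lo B i <_) (sym q≡hi) (isBox a i)

  Straddles : Facet d → Fin d → Set
  Straddles G k = lo (rect G) k < q k × q k < hi (rect G) k

  InRidge : Fin d → Fin d → Point d → Set
  InRidge j k x = x j ≡ q j × x k ≡ q k × (∀ i → i ≢ j → i ≢ k → lo B i < x i × x i < hi B i)

  InRidge-sym : ∀ {j k x} → InRidge j k x → InRidge k j x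
  InRidge-sym (xj , xk , x∈B) = xk , xj , λ i i≢k i≢j → x∈B i i≢j i≢k

  ∃-InRidge : ∀ j k → ∃ (InRidge j k)
  ∃-InRidge j k =
    x , updateAt-updates-earlier centre q j k , updateAt-updates k _ , x∈B
    where
    centre : Point d
    centre i = proj₁ (<-dense (isBox a i))
    x : Point d
    x = updateAt (updateAt centre j (const (q j))) k (const (q k))
    x∈B : ∀ i → i ≢ j → i ≢ k → lo B i < x i × x i < hi B i
    x∈B i i≢j i≢k =
      subst (λ v → lo B i < v × v < hi B i)
            (sym (trans (updateAt-minimal i k _ i≢k) (updateAt-minimal i j centre i≢j)))
            (proj₂ (<-dense (isBox a i)))

  record CornerBorder (G : Facet d) (j : Fin d) : Set where
    field
      axis≡    : axis G ≡ j
      isFacet  : IsFacet G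
      isBorder : IsBorder P G
      ≈border  : ∀ x → (x ∈R rect G → InBorder P j (q j) x) × (InBorder P j (q j) x → x ∈R rect G)

    B-face⊆ : ∀ x → x ∈R faceAt B j (q j) → x ∈R rect G
    B-face⊆ x x∈ = proj₂ (≈border x)
      (a , (j , faceAt B j (q j)) , faceAt-isFacetOf B j (corner j) , refl
         , cong proj₁ (faceAt-axis B j (q j)) , x∈)

    q∈G : q ∈R rect G
    q∈G = B-face⊆ q (∈-faceAt B j refl (λ i _ → q∈B i))

    flat : lo (rect G) j ≡ hi (rect G) j
    flat = proj₁ (isFacet j) (sym axis≡)

    lo-axis : lo (rect G) j ≡ q j
    lo-axis = ≤-antisym (proj₁ (q∈G j)) (subst (q j ≤_) (sym flat) (proj₂ (q∈G j)))

    hi-axis : hi (rect G) j ≡ q j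
    hi-axis = trans (sym flat) lo-axis

    ∈⇒axis≡ : ∀ {x} → x ∈R rect G → x j ≡ q j
    ∈⇒axis≡ {x} x∈ = ≤-antisym (subst (x j ≤_) hi-axis (proj₂ (x∈ j)))
                                (subst (_≤ x j) lo-axis (proj₁ (x∈ j)))

    nondegenerate : ∀ {i} → i ≢ j → lo (rect G) i < hi (rect G) i
    nondegenerate i≢j = proj₂ (isFacet _) (λ i≡axis → i≢j (trans i≡axis axis≡))

    spans-B : ∀ {i} → i ≢ j → lo (rect G) i ≤ lo B i × hi B i ≤ hi (rect G) i
    spans-B {i} i≢j =
      subst (λ s → lo (rect G) i ≤ proj₁ s × proj₂ s ≤ hi (rect G) i)
            (faceAt-other B j (q j) i≢j)
            (⊆⇒bounds (faceAt-lo≤hi B j (q j) (<⇒≤ ∘ isBox a)) B-face⊆ i)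

    ridge⊆ : ∀ {k x} → InRidge j k x → x ∈R rect G
    ridge⊆ {k} {x} (xj , xk , x∈B) i with i ≟ᶠ j | i ≟ᶠ k
    ... | yes refl | _ rewrite xj = q∈G i
    ... | no _ | yes refl rewrite xk = q∈G i
    ... | no i≢j | no i≢k =
      let (l , u)   = x∈B i i≢j i≢k
          (sl , su) = spans-B i≢j
      in ≤-trans sl (<⇒≤ l) , ≤-trans (<⇒≤ u) su

    ridge⊆interior : ∀ {k x} → k ≢ j → Straddles G k → InRidge j k x → InInt x (rect G)
    ridge⊆interior {k} {x} k≢j (lo<q , q<hi) (xj , xk , x∈B) i with i ≟ᶠ j | i ≟ᶠ k
    ... | yes refl | _ = inj₂ (flat , trans xj (sym lo-axis))
    ... | no i≢j | yes refl rewrite xk = inj₁ (nondegenerate i≢j , lo<q , q<hi)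
    ... | no i≢j | no i≢k =
      let (l , u)   = x∈B i i≢j i≢k
          (sl , su) = spans-B i≢j
      in inj₁ (nondegenerate i≢j , ≤-<-trans sl l , <-≤-trans u su)

  open CornerBorder

  cornerBorder : ∀ {G} → InBFBq P a q G → ∃ (CornerBorder G)
  cornerBorder {G} (f , (f∈B , q∈f) , interiorPos , isFacetG , axisG≡ , ≈b) = axis f , record
    { axis≡    = axisG≡
    ; isFacet  = isFacetG
    ; isBorder = axis f , pos f , interiorPos , (a , f , f∈B , refl , refl) , isFacetG , axisG≡ , ≈b
    ; ≈border  = subst (λ t → ∀ x → (x ∈R rect G → InBorder P (axis f) t x)
                                   × (InBorder P (axis f) t x → x ∈R rect G))
                       (IsFacetOf⇒pos≡ f∈B q∈f) ≈b
    }

  ≐⇒axis≡ : ∀ {G H j k} → CornerBorder G j → CornerBorder H k → G ≐ H → j ≡ k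
  ≐⇒axis≡ bG bH G≐H = trans (sym (axis≡ bG)) (trans (proj₁ G≐H) (axis≡ bH))

  sameAxis⇒≐ : ∀ {G H j} → CornerBorder G j → CornerBorder H j → G ≐ H
  sameAxis⇒≐ {G} {H} bG bH =
    trans (axis≡ bG) (sym (axis≡ bH))
    , λ i → cong₂ _,_ (≤-antisym (proj₁ (H⊆G i)) (proj₁ (G⊆H i)))
                      (≤-antisym (proj₂ (G⊆H i)) (proj₂ (H⊆G i)))
    where
    G⊆H = ⊆⇒bounds (IsFacet⇒lo≤hi (isFacet bG)) λ x → proj₂ (≈border bH x) ∘ proj₁ (≈border bG x)
    H⊆G = ⊆⇒bounds (IsFacet⇒lo≤hi (isFacet bH)) λ x → proj₂ (≈border bG x) ∘ proj₁ (≈border bH x)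

  straddles⇒properlyTouches : ∀ {G H j k} → CornerBorder G j → CornerBorder H k → k ≢ j
    → Straddles G k → ProperlyTouches G H
  straddles⇒properlyTouches {j = j} {k} bG bH k≢j G-k =
    let x , x∈ridge = ∃-InRidge j k
    in (x , ridge⊆interior bG k≢j G-k x∈ridge , ridge⊆ bH (InRidge-sym x∈ridge))
       , tatami _ _ (isBorder bG) (isBorder bH) (k≢j ∘ sym ∘ ≐⇒axis≡ bG bH)

  properlyTouches⇒straddles : ∀ {G H j k} → CornerBorder G j → CornerBorder H k → k ≢ j
    → ProperlyTouches G H → Straddles G k
  properlyTouches⇒straddles {G} {k = k} bG bH k≢j ((x , x∈G , x∈H) , _) with x∈G k
  ... | inj₁ (_ , l , u) = subst (λ v → lo (rect G) k < v × v < hi (rect G) k) (∈⇒axis≡ bH x∈H) (l , u)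
  ... | inj₂ (lo≡hi , _) = ⊥-elim (<-irrefl lo≡hi (nondegenerate bG k≢j))

  ¬straddle-each-other : ∀ {G H j k} → CornerBorder G j → CornerBorder H k → k ≢ j
    → Straddles G k → Straddles H j → ⊥
  ¬straddle-each-other {j = j} {k} bG bH k≢j G-k H-j =
    let x , x∈ridge = ∃-InRidge j k
    in proj₂ (straddles⇒properlyTouches bG bH k≢j G-k)
             (x , ridge⊆interior bG k≢j G-k x∈ridge
                , ridge⊆interior bH (≢-sym k≢j) H-j (InRidge-sym x∈ridge))

  above-spec : ∀ i → ∃[ y ] (q i < y × y < hi (bbox P) i
                             × ∀ c → lo (block P c) i ≤ y → lo (block P c) i ≤ q i)
  above-spec i = ∃-gap-above (λ c → lo (block P c) i) (proj₂ (q∈bbox-strict i))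

  below-spec : ∀ i → ∃[ y ] (lo (bbox P) i < y × y < q i
                             × ∀ c → y ≤ hi (block P c) i → q i ≤ hi (block P c) i)
  below-spec i = ∃-gap-below (λ c → hi (block P c) i) (proj₁ (q∈bbox-strict i))

  above below : Fin d → ℚ
  above i = proj₁ (above-spec i)
  below i = proj₁ (below-spec i)

  q<above : ∀ i → q i < above i
  q<above i = proj₁ (proj₂ (above-spec i))

  above-gap : ∀ i c → lo (block P c) i ≤ above i → lo (block P c) i ≤ q i
  above-gap i = proj₂ (proj₂ (proj₂ (above-spec i)))

  above∈bbox : ∀ i → lo (bbox P) i ≤ above i × above i ≤ hi (bbox P) i
  above∈bbox i = <⇒≤ (<-trans (proj₁ (q∈bbox-strict i)) (q<above i))
               , <⇒≤ (proj₁ (proj₂ (proj₂ (above-spec i))))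

  below<q : ∀ i → below i < q i
  below<q i = proj₁ (proj₂ (proj₂ (below-spec i)))

  below-gap : ∀ i c → below i ≤ hi (block P c) i → q i ≤ hi (block P c) i
  below-gap i = proj₂ (proj₂ (proj₂ (below-spec i)))

  below∈bbox : ∀ i → lo (bbox P) i ≤ below i × below i ≤ hi (bbox P) i
  below∈bbox i = <⇒≤ (proj₁ (proj₂ (below-spec i)))
               , <⇒≤ (<-trans (below<q i) (proj₂ (q∈bbox-strict i)))

  Endpoint : Rect d → Fin d → Set
  Endpoint r i = q i ≡ lo r i ⊎ q i ≡ hi r i

  overlap-at-lo : ∀ c {i} → q i ≡ lo B i → lo (block P c) i ≤ q i → q i < hi (block P c) i
    → OpenOverlap (block P c) B i
  overlap-at-lo c {i} q≡lo l u =
    <-intervals-meet (isBox c i) (isBox a i) (≤-<-trans l (q<hi-B q≡lo)) (subst (_< hi (block P c) i) q≡lo u)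

  overlap-at-hi : ∀ c {i} → q i ≡ hi B i → lo (block P c) i < q i → q i ≤ hi (block P c) i
    → OpenOverlap (block P c) B i
  overlap-at-hi c {i} q≡hi l u =
    <-intervals-meet (isBox c i) (isBox a i) (subst (lo (block P c) i <_) q≡hi l) (<-≤-trans (lo-B<q q≡hi) u)

  module Probe (axes : List (Fin d)) where

    -- just outside B along the axes in the list, just inside B along the others
    coordinate : ∀ {i} → Dec (i ∈ axes) → Endpoint B i → ℚ
    coordinate {i} (yes _) (inj₁ _) = below i
    coordinate {i} (yes _) (inj₂ _) = above i
    coordinate {i} (no _)  (inj₁ _) = above i
    coordinate {i} (no _)  (inj₂ _) = below i

    ∈axes? : ∀ i → Dec (i ∈ axes)
    ∈axes? i = anyList? (i ≟ᶠ_) axes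

    probe : Point d
    probe i = coordinate (∈axes? i) (corner i)

    coordinate∈bbox : ∀ {i} (i∈? : Dec (i ∈ axes)) (s : Endpoint B i)
      → lo (bbox P) i ≤ coordinate i∈? s × coordinate i∈? s ≤ hi (bbox P) i
    coordinate∈bbox (yes _) (inj₁ _) = below∈bbox _
    coordinate∈bbox (yes _) (inj₂ _) = above∈bbox _
    coordinate∈bbox (no _)  (inj₁ _) = above∈bbox _
    coordinate∈bbox (no _)  (inj₂ _) = below∈bbox _

    coordinate∉B : ∀ {i} (i∈? : Dec (i ∈ axes)) (s : Endpoint B i) → i ∈ axes
      → ¬ (lo B i ≤ coordinate i∈? s × coordinate i∈? s ≤ hi B i)
    coordinate∉B (yes _) (inj₁ q≡lo) _ (l , _) = <-irrefl (sym q≡lo) (≤-<-trans l (below<q _))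
    coordinate∉B (yes _) (inj₂ q≡hi) _ (_ , u) = <-irrefl q≡hi (<-≤-trans (q<above _) u)
    coordinate∉B (no i∉) _ i∈ = contradiction i∈ i∉

    coordinate-overlap : ∀ c {i} (i∈? : Dec (i ∈ axes)) (s : Endpoint B i)
      → lo (block P c) i ≤ coordinate i∈? s × coordinate i∈? s ≤ hi (block P c) i
      → OpenOverlap (block P c) B i ⊎ (i ∈ axes × Endpoint (block P c) i)
    coordinate-overlap c {i} (yes i∈) (inj₁ q≡lo) (l , u) with q i ≟ℚ hi (block P c) i
    ... | yes q≡hi = inj₂ (i∈ , inj₂ q≡hi)
    ... | no q≢hi = inj₁ (overlap-at-lo c q≡lo (<⇒≤ (≤-<-trans l (below<q i)))
                                               (≤∧≢⇒< (below-gap i c u) q≢hi))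
    coordinate-overlap c {i} (yes i∈) (inj₂ q≡hi) (l , u) with q i ≟ℚ lo (block P c) i
    ... | yes q≡lo = inj₂ (i∈ , inj₁ q≡lo)
    ... | no q≢lo = inj₁ (overlap-at-hi c q≡hi (≤∧≢⇒< (above-gap i c l) (q≢lo ∘ sym))
                                               (<⇒≤ (<-≤-trans (q<above i) u)))
    coordinate-overlap c (no _) (inj₁ q≡lo) (l , u) =
      inj₁ (overlap-at-lo c q≡lo (above-gap _ c l) (<-≤-trans (q<above _) u))
    coordinate-overlap c (no _) (inj₂ q≡hi) (l , u) =
      inj₁ (overlap-at-hi c q≡hi (≤-<-trans l (below<q _)) (below-gap _ c u))

    coordinate-straddles : ∀ {G m n} → CornerBorder G m → n ≢ m
      → (n∈? : Dec (n ∈ axes)) (s : Endpoint B n) → n ∈ axes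
      → lo (rect G) n ≤ coordinate n∈? s × coordinate n∈? s ≤ hi (rect G) n → Straddles G n
    coordinate-straddles bG n≢m (yes _) (inj₁ q≡lo) _ (l , _) =
      ≤-<-trans l (below<q _) , <-≤-trans (q<hi-B q≡lo) (proj₂ (spans-B bG n≢m))
    coordinate-straddles bG n≢m (yes _) (inj₂ q≡hi) _ (_ , u) =
      ≤-<-trans (proj₁ (spans-B bG n≢m)) (lo-B<q q≡hi) , <-≤-trans (q<above _) u
    coordinate-straddles bG n≢m (no n∉) _ n∈ _ = contradiction n∈ n∉

    probe∈bbox : probe ∈R bbox P
    probe∈bbox i = coordinate∈bbox (∈axes? i) (corner i)

    C : Fin (nblk P)
    C = proj₁ (covers probe probe∈bbox)

    probe∈C : probe ∈R block P C
    probe∈C = proj₂ (covers probe probe∈bbox)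

    C≢a : ∀ {m₀} → m₀ ∈ axes → C ≢ a
    C≢a {m₀} m₀∈ C≡a =
      coordinate∉B (∈axes? m₀) (corner m₀) m₀∈ (subst (λ c → probe ∈R block P c) C≡a probe∈C m₀)

    ∃-endpoint : ∀ {m₀} → m₀ ∈ axes → ∃[ m ] (m ∈ axes × Endpoint (block P C) m)
    ∃-endpoint m₀∈ with anyFin? (λ m → ∈axes? m
                                       ×-dec ((q m ≟ℚ lo (block P C) m) ⊎-dec (q m ≟ℚ hi (block P C) m)))
    ... | yes found = found
    ... | no none = ⊥-elim (disjoint C a (C≢a m₀∈) (interiors-meet (isBox C) (isBox a) meet))
      where
      meet : ∀ i → OpenOverlap (block P C) B i
      meet i = Sum.[ id , (λ endpoint → contradiction (i , endpoint) none) ]′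
                        (coordinate-overlap C (∈axes? i) (corner i) (probe∈C i))

    endpoint⇒straddles : ∀ {m} → Endpoint (block P C) m
      → ∀ {G n} → CornerBorder G m → n ∈ axes → n ≢ m → Straddles G n
    endpoint⇒straddles {m} endpoint {G} {n} bG n∈ n≢m =
      coordinate-straddles bG n≢m (∈axes? n) (corner n) n∈
        (subst (λ v → lo (rect G) n ≤ v × v ≤ hi (rect G) n) (updateAt-minimal n m probe n≢m) (y∈G n))
      where
      y : Point d
      y = updateAt probe m (const (q m))
      y∈C-face : y ∈R faceAt (block P C) m (q m)
      y∈C-face = ∈-faceAt (block P C) m (updateAt-updates m probe) λ i i≢m →
        subst (λ v → lo (block P C) i ≤ v × v ≤ hi (block P C) i)
              (sym (updateAt-minimal i m probe i≢m)) (probe∈C i)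
      y∈G : y ∈R rect G
      y∈G = proj₂ (≈border bG y)
        (C , (m , faceAt (block P C) m (q m)) , faceAt-isFacetOf (block P C) m endpoint , refl
           , cong proj₁ (faceAt-axis (block P C) m (q m)) , y∈C-face)

  ∃-straddling-axis : ∀ (axes : List (Fin d)) {m₀} → m₀ ∈ axes
    → ∃[ m ] (m ∈ axes × ∀ {G n} → CornerBorder G m → n ∈ axes → n ≢ m → Straddles G n)
  ∃-straddling-axis axes m₀∈ =
    let m , m∈ , endpoint = ∃-endpoint m₀∈ in m , m∈ , endpoint⇒straddles endpoint
    where open Probe axes

  ≐-straddles : ∀ {G H k} → G ≐ H → Straddles H k → Straddles G k
  ≐-straddles {k = k} (_ , G≡H) = subst (λ s → proj₁ s < q k × q k < proj₂ s) (sym (G≡H k))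

  touches⇒straddles : ∀ {G H j k} → CornerBorder G j → CornerBorder H k → k ≢ j
    → Touches G H → Straddles G k
  touches⇒straddles bG bH k≢j (inj₁ G≐H) = contradiction (sym (≐⇒axis≡ bG bH G≐H)) k≢j
  touches⇒straddles bG bH k≢j (inj₂ G→H) = properlyTouches⇒straddles bG bH k≢j G→H

  straddles⇒touches : ∀ {G H j k} → CornerBorder G j → CornerBorder H k → k ≢ j
    → Straddles G k → Touches G H
  straddles⇒touches bG bH k≢j = inj₂ ∘ straddles⇒properlyTouches bG bH k≢j

  touches-antisym : ∀ {G H j k} → CornerBorder G j → CornerBorder H k
    → Touches G H → Touches H G → G ≐ H
  touches-antisym {j = j} {k} bG bH G→H H→G with j ≟ᶠ k
  ... | yes refl = sameAxis⇒≐ bG bH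
  ... | no j≢k = ⊥-elim (¬straddle-each-other bG bH (≢-sym j≢k)
                           (touches⇒straddles bG bH (≢-sym j≢k) G→H)
                           (touches⇒straddles bH bG j≢k H→G))

  touches-total : ∀ {G H j k} → CornerBorder G j → CornerBorder H k
    → Touches G H ⊎ Touches H G
  touches-total {j = j} {k} bG bH with j ≟ᶠ k
  ... | yes refl = inj₁ (inj₁ (sameAxis⇒≐ bG bH))
  ... | no j≢k with ∃-straddling-axis (j ∷ k ∷ []) (here refl)
  ... | _ , here refl , straddling =
        inj₁ (straddles⇒touches bG bH (≢-sym j≢k) (straddling bG (there (here refl)) (≢-sym j≢k)))
  ... | _ , there (here refl) , straddling =
        inj₂ (straddles⇒touches bH bG j≢k (straddling bH (here refl) j≢k))
  ... | _ , there (there ()) , _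

  touches-straddles-trans : ∀ {G H K j k l} → CornerBorder G j → CornerBorder H k → CornerBorder K l
    → l ≢ j → Touches G H → Touches H K → Straddles G l
  touches-straddles-trans {j = j} {k} {l} bG bH bK l≢j G→H H→K with k ≟ᶠ j | k ≟ᶠ l
  ... | yes refl | _ = ≐-straddles (sameAxis⇒≐ bG bH) (touches⇒straddles bH bK l≢j H→K)
  ... | no _ | yes refl = touches⇒straddles bG bH l≢j G→H
  ... | no k≢j | no k≢l with ∃-straddling-axis (j ∷ k ∷ l ∷ []) (here refl)
  ... | _ , here refl , straddling = straddling bG (there (there (here refl))) l≢j
  ... | _ , there (here refl) , straddling =
        ⊥-elim (¬straddle-each-other bG bH k≢j (touches⇒straddles bG bH k≢j G→H)
                                     (straddling bH (here refl) (≢-sym k≢j)))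
  ... | _ , there (there (here refl)) , straddling =
        ⊥-elim (¬straddle-each-other bH bK (≢-sym k≢l) (touches⇒straddles bH bK (≢-sym k≢l) H→K)
                                     (straddling bK (there (here refl)) k≢l))
  ... | _ , there (there (there ())) , _

  touches-trans : ∀ {G H K j k l} → CornerBorder G j → CornerBorder H k → CornerBorder K l
    → Touches G H → Touches H K → Touches G K
  touches-trans {j = j} {l = l} bG bH bK G→H H→K with j ≟ᶠ l
  ... | yes refl = inj₁ (sameAxis⇒≐ bG bK)
  ... | no j≢l = straddles⇒touches bG bK (≢-sym j≢l)
                   (touches-straddles-trans bG bH bK (≢-sym j≢l) G→H H→K)

lemma1 : ∀ (d : ℕ) (P : Floorplan d) → IsDFloorplan P
    → (a : Fin (nblk P)) (q : Point d)
    → IsCorner q (block P a) → ¬ OnBoundary q (bbox P)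
    → TotalOrderOn (InBFBq P a q) Touches
lemma1 d P ((_ , isBox , ⊆bbox , covers , disjoint) , _ , tatami) a q corner ¬∂ = record
  { refl′   = λ _ _ → inj₁ (refl , λ _ → refl)
  ; antisym = λ _ _ G∈ H∈ → touches-antisym (proj₂ (cornerBorder G∈)) (proj₂ (cornerBorder H∈))
  ; trans′  = λ _ _ _ G∈ H∈ K∈ →
      touches-trans (proj₂ (cornerBorder G∈)) (proj₂ (cornerBorder H∈)) (proj₂ (cornerBorder K∈))
  ; total   = λ _ _ G∈ H∈ → touches-total (proj₂ (cornerBorder G∈)) (proj₂ (cornerBorder H∈))
  }
  where open CornerBorders P isBox ⊆bbox covers disjoint tatami a q corner ¬∂
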